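{- Let $x, y \in \mathbb{Z}$ and let $p \geq 3$ be a prime such that $x^2 - 2 = y^p$ and $y \neq -1$. Then $x$ and $y$ are both odd, $y \equiv 7 \pmod{8}$, and every prime dividing $y$ is congruent to $\pm 1 \pmod{8}$. -}

module Defs where

{-# OPTIONS --safe #-}
-- Reduction modulo 8: for odd p ≥ 3 one has y ^ p ≡ y ^ 3 (mod 8), because y ^ 5 ≡ y ^ 3,
-- and inspecting the residues of x ^ 2 - 2 ≡ y ^ 3 (mod 8) forces x odd and y ≡ 7.
-- Every divisor q of y divides x ^ 2 - 2 with x odd, and every such divisor n is ≡ ±1 (mod 8)
-- by descent: replacing x by its residue s mod n, or by n - s, gives an odd u ≤ n with
-- u ^ 2 ≡ 2 (mod n); then u ^ 2 - 2 = m n with m < n, the induction hypothesis gives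
-- m ≡ ±1, and u ^ 2 - 2 ≡ -1 (mod 8) leaves only n ≡ ±1.
module Submission where

open import Defs
open import Data.Nat using (ℕ; _≤_)
open import Data.Nat.Primality using (Prime)
open import Data.Integer using (ℤ; +_; -_; _-_; _^_; _%_)
open import Data.Integer.Divisibility using (_∣_)
open import Data.Product using (_×_)
open import Data.Sum using (_⊎_)
open import Relation.Binary.PropositionalEquality using (_≡_; _≢_)
open import Relation.Nullary using (¬_)

import Data.Nat as ℕ
open import Data.Nat using (zero; suc; _<_; _≟_; s≤s; z≤n)
import Data.Nat.Properties as ℕₚ
open import Data.Nat.Properties using (allUpTo?)
open import Data.Nat.DivMod using (m/n*n≡m; m<n*o⇒m/o<n)
import Data.Nat.Divisibility as ℕ∣
open import Data.Nat.Induction using (<-rec)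
open import Data.Nat.Primality using (prime⇒irreducible)
open import Data.Integer using (_+_; _*_; _⊖_; ∣_∣; _%ℕ_; _/ℕ_)
import Data.Integer.Properties as ℤₚ
open import Data.Integer.DivMod using (a≡a%ℕn+[a/ℕn]*n; n%ℕd<d)
import Data.Integer.Divisibility.Signed as Signed
open import Data.Integer.Tactic.RingSolver using (solve-∀)
open import Data.Integer.Solver using (module +-*-Solver)
open +-*-Solver using (solve; _:-_; _:*_; _:^_; _:=_)
open import Data.Product using (∃-syntax; _,_; proj₁; proj₂; map₁)
open import Data.Sum using (inj₁; inj₂)
open import Relation.Binary.PropositionalEquality
  using (refl; sym; trans; cong; subst; subst₂; module ≡-Reasoning)
open import Relation.Nullary using (yes; no; contradiction)
import Relation.Nullary.Decidable as Dec
open import Relation.Nullary.Decidable using (Dec; from-yes; _×-dec_; _⊎-dec_; _→-dec_; ¬?)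

infix 4 _≡_mod_ _≡?_mod_

-- A record rather than a function, so that a, b and n are inferable from a congruence.
record _≡_mod_ (a b n : ℤ) : Set where
  constructor ≡-mod
  field
    n∣a-b : n Signed.∣ a - b

open _≡_mod_

_≡?_mod_ : ∀ a b n → Dec (a ≡ b mod n)
_≡?_mod_ a b n = Dec.map′ ≡-mod n∣a-b (n Signed.∣? a - b)

≡-mod-refl : ∀ {a n} → a ≡ a mod n
≡-mod-refl {a} {n} = ≡-mod (Signed.divides (+ 0) (trans (ℤₚ.+-inverseʳ a) (sym (ℤₚ.*-zeroˡ n))))

≡-mod-sym : ∀ {a b n} → a ≡ b mod n → b ≡ a mod n
≡-mod-sym {a} {b} {n} (≡-mod n∣a-b) = ≡-mod (subst (n Signed.∣_) (flip a b) (Signed.∣m⇒∣-m n∣a-b))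
  where
  flip : ∀ a b → - (a - b) ≡ b - a
  flip = solve-∀

≡-mod-trans : ∀ {a b c n} → a ≡ b mod n → b ≡ c mod n → a ≡ c mod n
≡-mod-trans {a} {b} {c} {n} (≡-mod n∣a-b) (≡-mod n∣b-c) =
  ≡-mod (subst (n Signed.∣_) (telescope a b c) (Signed.∣m∣n⇒∣m+n n∣a-b n∣b-c))
  where
  telescope : ∀ a b c → (a - b) + (b - c) ≡ a - c
  telescope = solve-∀

+-cong-mod : ∀ {a b c d n} → a ≡ b mod n → c ≡ d mod n → a + c ≡ b + d mod n
+-cong-mod {a} {b} {c} {d} {n} (≡-mod n∣a-b) (≡-mod n∣c-d) =
  ≡-mod (subst (n Signed.∣_) (regroup a b c d) (Signed.∣m∣n⇒∣m+n n∣a-b n∣c-d))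
  where
  regroup : ∀ a b c d → (a - b) + (c - d) ≡ (a + c) - (b + d)
  regroup = solve-∀

*-cong-mod : ∀ {a b c d n} → a ≡ b mod n → c ≡ d mod n → a * c ≡ b * d mod n
*-cong-mod {a} {b} {c} {d} {n} (≡-mod n∣a-b) (≡-mod n∣c-d) =
  ≡-mod (subst (n Signed.∣_) (regroup a b c d)
    (Signed.∣m∣n⇒∣m+n (Signed.∣m⇒∣m*n c n∣a-b) (Signed.∣n⇒∣m*n b n∣c-d)))
  where
  regroup : ∀ a b c d → (a - b) * c + b * (c - d) ≡ a * c - b * d
  regroup = solve-∀

^-cong-mod : ∀ {a b n} k → a ≡ b mod n → a ^ k ≡ b ^ k mod n
^-cong-mod zero    a≡b = ≡-mod-refl
^-cong-mod (suc k) a≡b = *-cong-mod a≡b (^-cong-mod k a≡b)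

≡-mod-%ℕ : ∀ a d .{{_ : ℕ.NonZero d}} → a ≡ + (a %ℕ d) mod + d
≡-mod-%ℕ a d = ≡-mod (Signed.divides (a /ℕ d) (begin
  a - + r                        ≡⟨ cong (_- + r) (a≡a%ℕn+[a/ℕn]*n a d) ⟩
  (+ r + (a /ℕ d) * + d) - + r   ≡⟨ cancel (+ r) ((a /ℕ d) * + d) ⟩
  (a /ℕ d) * + d                 ∎))
  where
  open ≡-Reasoning
  r : ℕ
  r = a %ℕ d
  cancel : ∀ r q → (r + q) - r ≡ q
  cancel = solve-∀

-- For n : ℕ, Odd (+ n) unfolds to ¬ (2 ∣ n) in ℕ.
Odd : ℤ → Set
Odd a = ¬ (+ 2 ∣ a)

odd-divisor : ∀ {d a} → d ∣ a → Odd a → Odd d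
odd-divisor d∣a a-odd 2∣d = a-odd (ℕ∣.∣-trans 2∣d d∣a)

Odd-resp-≡-mod8 : ∀ {a b} → a ≡ b mod + 8 → Odd a → Odd b
Odd-resp-≡-mod8 {a} {b} (≡-mod 8∣a-b) a-odd 2∣b = a-odd (Signed.∣⇒∣ᵤ 2∣a)
  where
  2∣a-b : + 2 Signed.∣ a - b
  2∣a-b = Signed.∣-trans (Signed.divides (+ 4) refl) 8∣a-b
  cancel : ∀ a b → (a - b) + b ≡ a
  cancel = solve-∀
  2∣a : + 2 Signed.∣ a
  2∣a = subst (+ 2 Signed.∣_) (cancel a b) (Signed.∣m∣n⇒∣m+n 2∣a-b (Signed.∣ᵤ⇒∣ 2∣b))

odd²-2≡-1-mod8 : ∀ {t} → Odd t → t ^ 2 - + 2 ≡ - + 1 mod + 8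
odd²-2≡-1-mod8 {t} t-odd =
  ≡-mod-trans (+-cong-mod (^-cong-mod 2 t≡r) ≡-mod-refl) (table (n%ℕd<d t 8) (Odd-resp-≡-mod8 t≡r t-odd))
  where
  t≡r : t ≡ + (t %ℕ 8) mod + 8
  t≡r = ≡-mod-%ℕ t 8
  table : ∀ {r} → r < 8 → Odd (+ r) → (+ r) ^ 2 - + 2 ≡ - + 1 mod + 8
  table = from-yes (allUpTo? (λ r → ¬? (2 ℕ∣.∣? r) →-dec ((+ r) ^ 2 - + 2 ≡? - + 1 mod + 8)) 8)

odd²-2-odd : ∀ {t} → Odd t → Odd (t ^ 2 - + 2)
odd²-2-odd {t} t-odd = Odd-resp-≡-mod8 (≡-mod-sym (odd²-2≡-1-mod8 {t} t-odd)) (Dec.from-no (2 ℕ∣.∣? 1))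

^5≡^3-mod8 : ∀ y → y ^ 5 ≡ y ^ 3 mod + 8
^5≡^3-mod8 y =
  ≡-mod-trans (^-cong-mod 5 y≡r) (≡-mod-trans (table (n%ℕd<d y 8)) (≡-mod-sym (^-cong-mod 3 y≡r)))
  where
  y≡r : y ≡ + (y %ℕ 8) mod + 8
  y≡r = ≡-mod-%ℕ y 8
  table : ∀ {r} → r < 8 → (+ r) ^ 5 ≡ (+ r) ^ 3 mod + 8
  table = from-yes (allUpTo? (λ r → (+ r) ^ 5 ≡? (+ r) ^ 3 mod + 8) 8)

^-odd≡^3-mod8 : ∀ y {p} → 3 ≤ p → Odd (+ p) → y ^ p ≡ y ^ 3 mod + 8
^-odd≡^3-mod8 y {1} (s≤s ()) _
^-odd≡^3-mod8 y {2} (s≤s (s≤s ())) _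
^-odd≡^3-mod8 y {3} _ _ = ≡-mod-refl
^-odd≡^3-mod8 y {4} _ 4-odd = contradiction (ℕ∣.divides 2 refl) 4-odd
^-odd≡^3-mod8 y {suc (suc p@(suc (suc (suc j))))} _ 2+p-odd =
  ≡-mod-trans y⁵⁺ʲ≡y³⁺ʲ (^-odd≡^3-mod8 y (s≤s (s≤s (s≤s z≤n))) p-odd)
  where
  p-odd : Odd (+ p)
  p-odd 2∣p = 2+p-odd (ℕ∣.∣m∣n⇒∣m+n ℕ∣.∣-refl 2∣p)
  y⁵⁺ʲ≡y³⁺ʲ : y ^ (5 ℕ.+ j) ≡ y ^ (3 ℕ.+ j) mod + 8
  y⁵⁺ʲ≡y³⁺ʲ = subst₂ (_≡_mod + 8) (sym (ℤₚ.^-distribˡ-+-* y 5 j)) (sym (ℤₚ.^-distribˡ-+-* y 3 j))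
    (*-cong-mod (^5≡^3-mod8 y) ≡-mod-refl)

x²-2≡y³-mod8⇒odd∧≡7 : ∀ {x y} → x ^ 2 - + 2 ≡ y ^ 3 mod + 8 → Odd x × y %ℕ 8 ≡ 7
x²-2≡y³-mod8⇒odd∧≡7 {x} {y} x²-2≡y³ =
  map₁ (Odd-resp-≡-mod8 (≡-mod-sym x≡s)) (table (n%ℕd<d x 8) (n%ℕd<d y 8) s²-2≡r³)
  where
  x≡s : x ≡ + (x %ℕ 8) mod + 8
  x≡s = ≡-mod-%ℕ x 8
  s²-2≡r³ : (+ (x %ℕ 8)) ^ 2 - + 2 ≡ (+ (y %ℕ 8)) ^ 3 mod + 8
  s²-2≡r³ = ≡-mod-trans (≡-mod-sym (+-cong-mod (^-cong-mod 2 x≡s) ≡-mod-refl))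
              (≡-mod-trans x²-2≡y³ (^-cong-mod 3 (≡-mod-%ℕ y 8)))
  table : ∀ {s} → s < 8 → ∀ {r} → r < 8 → (+ s) ^ 2 - + 2 ≡ (+ r) ^ 3 mod + 8 → Odd (+ s) × r ≡ 7
  table = from-yes (allUpTo? (λ s → allUpTo? (λ r →
            ((+ s) ^ 2 - + 2 ≡? (+ r) ^ 3 mod + 8) →-dec (¬? (2 ℕ∣.∣? s) ×-dec (r ≟ 7))) 8) 8)

±1-mod8-cancel : ∀ {m n} → m ℕ.% 8 ≡ 1 ⊎ m ℕ.% 8 ≡ 7 → + m * + n ≡ - + 1 mod + 8 →
                 n ℕ.% 8 ≡ 1 ⊎ n ℕ.% 8 ≡ 7
±1-mod8-cancel {m} {n} m≡±1 mn≡-1 = table (n%ℕd<d (+ m) 8) (n%ℕd<d (+ n) 8) m≡±1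
  (≡-mod-trans (≡-mod-sym (*-cong-mod (≡-mod-%ℕ (+ m) 8) (≡-mod-%ℕ (+ n) 8))) mn≡-1)
  where
  table : ∀ {b} → b < 8 → ∀ {c} → c < 8 →
          b ≡ 1 ⊎ b ≡ 7 → + b * + c ≡ - + 1 mod + 8 → c ≡ 1 ⊎ c ≡ 7
  table = from-yes (allUpTo? (λ b → allUpTo? (λ c → ((b ≟ 1) ⊎-dec (b ≟ 7)) →-dec
            ((+ b * + c ≡? - + 1 mod + 8) →-dec ((c ≟ 1) ⊎-dec (c ≟ 7)))) 8) 8)

[n-s]²≡s²-mod-n : ∀ {n s} → s ≤ n → (+ (n ℕ.∸ s)) ^ 2 ≡ (+ s) ^ 2 mod + n
[n-s]²≡s²-mod-n {n} {s} s≤n = ≡-mod (Signed.divides (+ n - + s - + s) (begin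
  (+ (n ℕ.∸ s)) ^ 2 - (+ s) ^ 2  ≡⟨ cong (λ a → a ^ 2 - (+ s) ^ 2) +[n∸s]≡+n-+s ⟩
  (+ n - + s) ^ 2 - (+ s) ^ 2    ≡⟨ expand (+ n) (+ s) ⟩
  (+ n - + s - + s) * + n        ∎))
  where
  open ≡-Reasoning
  +[n∸s]≡+n-+s : + (n ℕ.∸ s) ≡ + n - + s
  +[n∸s]≡+n-+s = sym (trans (ℤₚ.m-n≡m⊖n n s) (ℤₚ.⊖-≥ s≤n))
  expand : ∀ n s → (n - s) ^ 2 - s ^ 2 ≡ (n - s - s) * n
  expand = solve 2 (λ n s → (n :- s) :^ 2 :- s :^ 2 := (n :- s :- s) :* n) refl

odd-representative : ∀ {n} → Odd (+ n) → ∀ t → ∃[ u ] Odd (+ u) × u ≤ n × (+ u) ^ 2 ≡ t ^ 2 mod + n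
odd-representative {zero}      0-odd _ = contradiction (2 ℕ∣.∣0) 0-odd
odd-representative {n@(suc _)} n-odd t = pick (2 ℕ∣.∣? s)
  where
  s : ℕ
  s = t %ℕ n
  s≤n : s ≤ n
  s≤n = ℕₚ.<⇒≤ (n%ℕd<d t n)
  s²≡t² : (+ s) ^ 2 ≡ t ^ 2 mod + n
  s²≡t² = ^-cong-mod 2 (≡-mod-sym (≡-mod-%ℕ t n))
  n-s-odd : 2 ℕ∣.∣ s → Odd (+ (n ℕ.∸ s))
  n-s-odd 2∣s 2∣n-s = n-odd (subst (2 ℕ∣.∣_) (ℕₚ.m+[n∸m]≡n s≤n) (ℕ∣.∣m∣n⇒∣m+n 2∣s 2∣n-s))
  pick : Dec (2 ℕ∣.∣ s) → ∃[ u ] Odd (+ u) × u ≤ n × (+ u) ^ 2 ≡ t ^ 2 mod + n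
  pick (no  s-odd) = s , s-odd , s≤n , s²≡t²
  pick (yes 2∣s)   =
    n ℕ.∸ s , n-s-odd 2∣s , ℕₚ.m∸n≤m n s , ≡-mod-trans ([n-s]²≡s²-mod-n s≤n) s²≡t²

smaller-cofactor : ∀ {n u} → 2 ≤ n → Odd (+ u) → u ≤ n → (+ u) ^ 2 ≡ + 2 mod + n →
                   ∃[ m ] m < n × (+ u) ^ 2 - + 2 ≡ + m * + n
smaller-cofactor {u = 0} _ 0-odd = contradiction (2 ℕ∣.∣0) 0-odd
smaller-cofactor {u = 1} (s≤s (s≤s _)) _ _ (≡-mod n∣-1) with ℕ∣.∣1⇒≡1 (Signed.∣⇒∣ᵤ n∣-1)
... | ()
smaller-cofactor {n@(suc _)} {u@(suc (suc _))} _ _ u≤n (≡-mod n∣u²-2) = m , m<n , u²-2≡mn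
  where
  a : ℕ
  a = u ℕ.* u ℕ.∸ 2
  u²-2≡a : (+ u) ^ 2 - + 2 ≡ + a
  u²-2≡a = begin
    (+ u) ^ 2 - + 2      ≡⟨ cong (_- + 2) (cong (+ u *_) (ℤₚ.*-identityʳ (+ u))) ⟩
    + u * + u - + 2      ≡⟨ cong (_- + 2) (ℤₚ.pos-* u u) ⟨
    + (u ℕ.* u) - + 2    ≡⟨ ℤₚ.m-n≡m⊖n (u ℕ.* u) 2 ⟩
    (u ℕ.* u) ⊖ 2        ≡⟨ ℤₚ.⊖-≥ (s≤s (s≤s z≤n)) ⟩
    + a                  ∎
    where open ≡-Reasoning
  n∣a : n ℕ∣.∣ a
  n∣a = subst (λ z → n ℕ∣.∣ ∣ z ∣) u²-2≡a (Signed.∣⇒∣ᵤ n∣u²-2)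
  m : ℕ
  m = a ℕ./ n
  -- a = u * u ∸ 2 < u * u ≤ n * n
  m<n : m < n
  m<n = m<n*o⇒m/o<n
    (ℕₚ.<-≤-trans (ℕₚ.∸-monoʳ-< {o = 0} (s≤s z≤n) (s≤s (s≤s z≤n))) (ℕₚ.*-mono-≤ u≤n u≤n))
  u²-2≡mn : (+ u) ^ 2 - + 2 ≡ + m * + n
  u²-2≡mn = trans u²-2≡a (trans (cong +_ (sym (m/n*n≡m n∣a))) (ℤₚ.pos-* m n))

odd²-2-divisor-odd : ∀ {n t} → Odd t → t ^ 2 ≡ + 2 mod + n → Odd (+ n)
odd²-2-divisor-odd {n} {t} t-odd (≡-mod n∣t²-2) =
  odd-divisor {+ n} {t ^ 2 - + 2} (Signed.∣⇒∣ᵤ n∣t²-2) (odd²-2-odd {t} t-odd)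

odd²-2-divisor≡±1-mod8 : ∀ n {t} → Odd t → t ^ 2 ≡ + 2 mod + n → n ℕ.% 8 ≡ 1 ⊎ n ℕ.% 8 ≡ 7
odd²-2-divisor≡±1-mod8 = <-rec Divisor≡±1 descent
  where
  Divisor≡±1 : ℕ → Set
  Divisor≡±1 n = ∀ {t} → Odd t → t ^ 2 ≡ + 2 mod + n → n ℕ.% 8 ≡ 1 ⊎ n ℕ.% 8 ≡ 7
  descent : ∀ n → (∀ {m} → m < n → Divisor≡±1 m) → Divisor≡±1 n
  descent 0 _ {t} t-odd t²≡2 = contradiction (2 ℕ∣.∣0) (odd²-2-divisor-odd {t = t} t-odd t²≡2)
  descent 1 _ _ _ = inj₁ refl
  descent n@(suc (suc _)) IH {t} t-odd t²≡2 =
    let u , u-odd , u≤n , u²≡t² = odd-representative (odd²-2-divisor-odd {t = t} t-odd t²≡2) t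
        m , m<n , u²-2≡mn      = smaller-cofactor (s≤s (s≤s z≤n)) u-odd u≤n (≡-mod-trans u²≡t² t²≡2)
        m-divisor : (+ u) ^ 2 ≡ + 2 mod + m
        m-divisor = ≡-mod (subst (+ m Signed.∣_) (sym u²-2≡mn) (Signed.∣m⇒∣m*n (+ n) Signed.∣-refl))
        mn≡-1 : + m * + n ≡ - + 1 mod + 8
        mn≡-1 = subst (_≡ - + 1 mod + 8) u²-2≡mn (odd²-2≡-1-mod8 {+ u} u-odd)
    in ±1-mod8-cancel {m} {n} (IH m<n {+ u} u-odd m-divisor) mn≡-1

prime≥3⇒odd : ∀ {p} → Prime p → 3 ≤ p → Odd (+ p)
prime≥3⇒odd p-prime 3≤p 2∣p with prime⇒irreducible p-prime 2∣p
... | inj₂ refl = contradiction 3≤p λ { (s≤s (s≤s ())) }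

theorem2p2 : (x y : ℤ) (p : ℕ) → Prime p → 3 ≤ p →
             x ^ 2 - + 2 ≡ y ^ p → y ≢ - + 1 →
             (¬ (+ 2 ∣ x)) × (¬ (+ 2 ∣ y)) × (y % + 8 ≡ 7) ×
             ((q : ℕ) → Prime q → + q ∣ y → (q Data.Nat.% 8 ≡ 1) ⊎ (q Data.Nat.% 8 ≡ 7))
theorem2p2 x y p p-prime 3≤p x²-2≡yᵖ _ = x-odd , y-odd , y%8≡7 , divisors≡±1
  where
  x²-2≡y³ : x ^ 2 - + 2 ≡ y ^ 3 mod + 8
  x²-2≡y³ = subst (_≡ y ^ 3 mod + 8) (sym x²-2≡yᵖ) (^-odd≡^3-mod8 y 3≤p (prime≥3⇒odd p-prime 3≤p))
  x-odd : Odd x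
  x-odd = proj₁ (x²-2≡y³-mod8⇒odd∧≡7 {x} {y} x²-2≡y³)
  y%8≡7 : y % + 8 ≡ 7
  y%8≡7 = proj₂ (x²-2≡y³-mod8⇒odd∧≡7 {x} {y} x²-2≡y³)
  y∣yᵏ : ∀ {k} → 1 ≤ k → y Signed.∣ y ^ k
  y∣yᵏ (s≤s {n = k} _) = Signed.∣m⇒∣m*n (y ^ k) Signed.∣-refl
  y∣x²-2 : y Signed.∣ x ^ 2 - + 2
  y∣x²-2 = subst (y Signed.∣_) (sym x²-2≡yᵖ) (y∣yᵏ (ℕₚ.≤-trans (s≤s z≤n) 3≤p))
  y-odd : Odd y
  y-odd = odd-divisor {y} {x ^ 2 - + 2} (Signed.∣⇒∣ᵤ y∣x²-2) (odd²-2-odd {x} x-odd)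
  divisors≡±1 : (q : ℕ) → Prime q → + q ∣ y → q ℕ.% 8 ≡ 1 ⊎ q ℕ.% 8 ≡ 7
  divisors≡±1 q _ q∣y =
    odd²-2-divisor≡±1-mod8 q {x} x-odd (≡-mod (Signed.∣-trans (Signed.∣ᵤ⇒∣ q∣y) y∣x²-2))
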